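{- Let $\mathcal{M}$ be a graph with a weight function $\omega\colon E(\mathcal{M})\to\mathbb{Z}_k$. If there exist $\varphi\in\mathrm{Aut}(\mathcal{M})$ and $\alpha\in\mathrm{Aut}(\mathbb{Z}_k)$ such that $\omega(e\varphi)=\alpha(\omega(e))$ for every edge $e$ of $\mathcal{M}$, then $\varphi$ has a lift to $\mathcal{M}^\omega$.
   Context: For a graph $\Gamma$ and a function (weight function) $\omega\colon E(\Gamma)\to\mathbb{Z}_k$, the cross-cover $\Gamma^\omega$ is the graph with vertex set $V(\Gamma)\times\mathbb{Z}_k$ in which, for every edge $e=uv$ of $\Gamma$ and every $i\in\mathbb{Z}_k$, the vertices $(u,i)$ and $(v,\omega(e)-i)$ are adjacent; $\pi\colon(u,i)\mapsto u$ is the natural projection. An automorphism $\varphi$ of $\Gamma$ lifts if there is an automorphism $\bar\varphi$ of $\Gamma^\omega$ with $\pi(x\bar\varphi)=\pi(x)\varphi$ for all vertices $x$ of $\Gamma^\omega$; $\bar\varphi$ is then called a lift of $\varphi$. -}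

module Defs where

open import Data.Nat using (ℕ; NonZero; _∸_; _+_)
open import Data.Nat.DivMod using (_mod_)
open import Data.Fin using (Fin; toℕ)
open import Data.Bool using (Bool; true; false; T)
open import Data.Product using (Σ; _×_; _,_; proj₁; proj₂)
open import Function.Bundles using (_↔_; Inverse)
open import Relation.Binary.PropositionalEquality using (_≡_; subst)

ℤ_ : ℕ → Set
ℤ_ k = Fin k

module _ {k : ℕ} .{{_ : NonZero k}} where
  _⊕_ : ℤ_ k → ℤ_ k → ℤ_ k
  a ⊕ b = (toℕ a + toℕ b) mod k

  ⊖_ : ℤ_ k → ℤ_ k
  ⊖ a = (k ∸ toℕ a) mod k

  _⊖_ : ℤ_ k → ℤ_ k → ℤ_ k
  a ⊖ b = a ⊕ (⊖ b)

  record AutZ : Set where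
    field
      perm : ℤ_ k ↔ ℤ_ k
      hom  : ∀ a b → Inverse.to perm (a ⊕ b) ≡ Inverse.to perm a ⊕ Inverse.to perm b

record Graph : Set where
  field
    n      : ℕ
    adj    : Fin n → Fin n → Bool
    sym    : ∀ u v → adj u v ≡ adj v u
    irrefl : ∀ u → adj u u ≡ false

  Edge : Fin n → Fin n → Set
  Edge u v = T (adj u v)

  flip : ∀ {u v} → Edge u v → Edge v u
  flip {u} {v} e = subst T (sym u v) e

open Graph public

-- A weight function ω : E(Γ) → ℤ_k; an edge uv is undirected, so its value
-- must not depend on the orientation in which it is presented.
record Weight (Γ : Graph) (k : ℕ) : Set where
  field
    ω     : ∀ u v → Edge Γ u v → ℤ_ k
    ω-sym : ∀ u v (e : Edge Γ u v) → ω u v e ≡ ω v u (flip Γ e)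

open Weight public

record Aut (Γ : Graph) : Set where
  field
    perm : Fin (n Γ) ↔ Fin (n Γ)
    pres : ∀ u v → adj Γ (Inverse.to perm u) (Inverse.to perm v) ≡ adj Γ u v

  φ : Fin (n Γ) → Fin (n Γ)
  φ = Inverse.to perm

  edge-img : ∀ {u v} → Edge Γ u v → Edge Γ (φ u) (φ v)
  edge-img {u} {v} e = subst T (Relation.Binary.PropositionalEquality.sym (pres u v)) e

-- The cross-cover Γ^ω: vertices V(Γ) × ℤ_k, with (u,i) ~ (v, ω(uv) - i).
module _ (Γ : Graph) {k : ℕ} .{{_ : NonZero k}} (W : Weight Γ k) where
  CVert : Set
  CVert = Fin (n Γ) × ℤ_ k

  CAdj : CVert → CVert → Set
  CAdj (u , i) (v , j) = Σ (Edge Γ u v) λ e → j ≡ (ω W u v e ⊖ i)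

  record CoverAut : Set where
    field
      perm : CVert ↔ CVert
      pres : ∀ x y → (CAdj x y → CAdj (Inverse.to perm x) (Inverse.to perm y))
                   × (CAdj (Inverse.to perm x) (Inverse.to perm y) → CAdj x y)

  Lifts : Aut Γ → Set
  Lifts F = Σ CoverAut λ ψ →
    ∀ (x : CVert) → proj₁ (Inverse.to (CoverAut.perm ψ) x) ≡ Aut.φ F (proj₁ x)

-- Since ω(eφ) = α(ω(e)), the map (u, i) ↦ (uφ, iα) is a lift: an automorphism α of ℤ_k
-- preserves differences, so it carries the cover edge (u, i) ~ (v, ω(e) − i) to
-- (uφ, iα) ~ (vφ, α(ω(e)) − iα) = (vφ, ω(eφ) − iα), and injectivity of α gives the converse.
module Submission where

open import Defs hiding (sym)
open import Data.Bool using (T)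
open import Data.Bool.Properties using (T-irrelevant)
open import Data.Fin using (toℕ)
open import Data.Fin.Properties using (toℕ-fromℕ<; toℕ-injective; toℕ<n; toℕ≤n)
open import Data.Nat using (ℕ; NonZero; _+_; _∸_; _%_)
open import Data.Nat.DivMod using (%-distribˡ-+; [m+n]%n≡m%n; m<n⇒m%n≡m)
open import Data.Nat.Properties using (+-assoc; m+[n∸m]≡n; m∸n+n≡m)
open import Data.Product using (_,_)
open import Data.Product.Function.NonDependent.Propositional using (_×-↔_)
open import Function.Bundles using (Inverse; Injection)
open import Function.Properties.Inverse using (↔⇒↣)
open import Relation.Binary.PropositionalEquality
  using (_≡_; refl; sym; trans; cong; cong₂; subst; module ≡-Reasoning)

module _ {k : ℕ} .{{_ : NonZero k}} where
  open ≡-Reasoning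

  toℕ≡toℕ%k : ∀ (a : ℤ_ k) → toℕ a ≡ toℕ a % k
  toℕ≡toℕ%k a = sym (m<n⇒m%n≡m (toℕ<n a))

  toℕ-⊕ : ∀ {a b : ℤ_ k} {m n} → toℕ a ≡ m % k → toℕ b ≡ n % k → toℕ (a ⊕ b) ≡ (m + n) % k
  toℕ-⊕ {a} {b} {m} {n} a≡m b≡n = begin
    toℕ (a ⊕ b)          ≡⟨ toℕ-fromℕ< _ ⟩
    (toℕ a + toℕ b) % k  ≡⟨ cong₂ (λ p q → (p + q) % k) a≡m b≡n ⟩
    (m % k + n % k) % k  ≡⟨ %-distribˡ-+ m n k ⟨
    (m + n) % k          ∎

  toℕ-⊖ : ∀ (a : ℤ_ k) → toℕ (⊖ a) ≡ (k ∸ toℕ a) % k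
  toℕ-⊖ a = toℕ-fromℕ< _

  ≡-from-toℕ≡[+k]%k : ∀ {x a : ℤ_ k} → toℕ x ≡ (toℕ a + k) % k → x ≡ a
  ≡-from-toℕ≡[+k]%k {x} {a} x≡a+k = toℕ-injective (begin
    toℕ x            ≡⟨ x≡a+k ⟩
    (toℕ a + k) % k  ≡⟨ [m+n]%n≡m%n (toℕ a) k ⟩
    toℕ a % k        ≡⟨ toℕ≡toℕ%k a ⟨
    toℕ a            ∎)

  ⊕-⊖-cancelʳ : ∀ (a c : ℤ_ k) → (a ⊕ c) ⊖ c ≡ a
  ⊕-⊖-cancelʳ a c = ≡-from-toℕ≡[+k]%k (begin
    toℕ ((a ⊕ c) ⊖ c)
      ≡⟨ toℕ-⊕ (toℕ-⊕ (toℕ≡toℕ%k a) (toℕ≡toℕ%k c)) (toℕ-⊖ c) ⟩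
    (toℕ a + toℕ c + (k ∸ toℕ c)) % k
      ≡⟨ cong (_% k) (+-assoc (toℕ a) (toℕ c) _) ⟩
    (toℕ a + (toℕ c + (k ∸ toℕ c))) % k
      ≡⟨ cong (λ m → (toℕ a + m) % k) (m+[n∸m]≡n (toℕ≤n c)) ⟩
    (toℕ a + k) % k
      ∎)

  ⊖-⊕-cancelʳ : ∀ (a c : ℤ_ k) → (a ⊖ c) ⊕ c ≡ a
  ⊖-⊕-cancelʳ a c = ≡-from-toℕ≡[+k]%k (begin
    toℕ ((a ⊖ c) ⊕ c)
      ≡⟨ toℕ-⊕ (toℕ-⊕ (toℕ≡toℕ%k a) (toℕ-⊖ c)) (toℕ≡toℕ%k c) ⟩
    (toℕ a + (k ∸ toℕ c) + toℕ c) % k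
      ≡⟨ cong (_% k) (+-assoc (toℕ a) _ (toℕ c)) ⟩
    (toℕ a + (k ∸ toℕ c + toℕ c)) % k
      ≡⟨ cong (λ m → (toℕ a + m) % k) (m∸n+n≡m (toℕ≤n c)) ⟩
    (toℕ a + k) % k
      ∎)

  ⊕-cancelʳ : ∀ (c : ℤ_ k) {a b} → a ⊕ c ≡ b ⊕ c → a ≡ b
  ⊕-cancelʳ c {a} {b} a+c≡b+c = begin
    a            ≡⟨ ⊕-⊖-cancelʳ a c ⟨
    (a ⊕ c) ⊖ c  ≡⟨ cong (_⊖ c) a+c≡b+c ⟩
    (b ⊕ c) ⊖ c  ≡⟨ ⊕-⊖-cancelʳ b c ⟩
    b            ∎

⊕-hom⇒⊖-hom : ∀ {k m} .{{_ : NonZero k}} .{{_ : NonZero m}} {f : ℤ_ k → ℤ_ m} →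
              (∀ a b → f (a ⊕ b) ≡ f a ⊕ f b) → ∀ a b → f (a ⊖ b) ≡ f a ⊖ f b
⊕-hom⇒⊖-hom {f = f} f-hom a b = ⊕-cancelʳ (f b) (begin
  f (a ⊖ b) ⊕ f b    ≡⟨ f-hom (a ⊖ b) b ⟨
  f ((a ⊖ b) ⊕ b)    ≡⟨ cong f (⊖-⊕-cancelʳ a b) ⟩
  f a                ≡⟨ ⊖-⊕-cancelʳ (f a) (f b) ⟨
  (f a ⊖ f b) ⊕ f b  ∎)
  where open ≡-Reasoning

module _ (Γ : Graph) {k : ℕ} .{{_ : NonZero k}} (W : Weight Γ k) (F : Aut Γ) (α : AutZ {k}) where
  private
    φ = Aut.φ F
    αᶠ = Inverse.to (AutZ.perm α)

  Compatible : Set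
  Compatible = ∀ u v (e : Edge Γ u v) → ω W (φ u) (φ v) (Aut.edge-img F e) ≡ αᶠ (ω W u v e)

  module _ (compatible : Compatible) where
    open ≡-Reasoning

    α-⊖-weight : ∀ u v (e : Edge Γ u v) i →
                 αᶠ (ω W u v e ⊖ i) ≡ ω W (φ u) (φ v) (Aut.edge-img F e) ⊖ αᶠ i
    α-⊖-weight u v e i = begin
      αᶠ (ω W u v e ⊖ i)                         ≡⟨ ⊕-hom⇒⊖-hom {f = αᶠ} (AutZ.hom α) (ω W u v e) i ⟩
      αᶠ (ω W u v e) ⊖ αᶠ i                      ≡⟨ cong (_⊖ αᶠ i) (compatible u v e) ⟨
      ω W (φ u) (φ v) (Aut.edge-img F e) ⊖ αᶠ i  ∎

    crossLift-preserves : ∀ {u v i j} →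
                          CAdj Γ W (u , i) (v , j) → CAdj Γ W (φ u , αᶠ i) (φ v , αᶠ j)
    crossLift-preserves {u} {v} {i} (e , j≡ω-i) =
      Aut.edge-img F e , trans (cong αᶠ j≡ω-i) (α-⊖-weight u v e i)

    crossLift-reflects : ∀ {u v i j} →
                         CAdj Γ W (φ u , αᶠ i) (φ v , αᶠ j) → CAdj Γ W (u , i) (v , j)
    crossLift-reflects {u} {v} {i} {j} (e′ , αj≡ω-αi) =
      e , Injection.injective (↔⇒↣ (AutZ.perm α)) (begin
        αᶠ j                                       ≡⟨ αj≡ω-αi ⟩
        ω W (φ u) (φ v) e′ ⊖ αᶠ i                  ≡⟨ cong (λ e″ → ω W (φ u) (φ v) e″ ⊖ αᶠ i) (T-irrelevant e′ _) ⟩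
        ω W (φ u) (φ v) (Aut.edge-img F e) ⊖ αᶠ i  ≡⟨ α-⊖-weight u v e i ⟨
        αᶠ (ω W u v e ⊖ i)                         ∎)
      where
        e : Edge Γ u v
        e = subst T (Aut.pres F u v) e′

    crossLift : CoverAut Γ W
    crossLift = record
      { perm = Aut.perm F ×-↔ AutZ.perm α
      ; pres = λ _ _ → crossLift-preserves , crossLift-reflects
      }

    compatible⇒lifts : Lifts Γ W F
    compatible⇒lifts = crossLift , λ _ → refl

corollary3p7 : (M : Graph) (k : ℕ) .{{_ : NonZero k}} (W : Weight M k)
    (F : Aut M) (α : AutZ {k}) →
    (∀ u v (e : Edge M u v) →
      ω W (Aut.φ F u) (Aut.φ F v) (Aut.edge-img F e)
        ≡ Inverse.to (AutZ.perm α) (ω W u v e)) →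
    Lifts M W F
corollary3p7 M k W F α = compatible⇒lifts M W F α
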